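{- Let $\Gamma\cup\{A\land B\}$ be a sharing-free set of named formulas (with $A\land B$ sharing no name with $\Gamma$), and let $G$ be a bl-graph total with respect to $\vdash\Gamma,A\land B$. Then $G=G{\upharpoonright}_{\mathrm{names}(\Gamma,A)}\sqcup G{\upharpoonright}_{\mathrm{names}(\Gamma,B)}$, and $G{\upharpoonright}_{\mathrm{names}(\Gamma,A)}$ and $G{\upharpoonright}_{\mathrm{names}(\Gamma,B)}$ are total with respect to $\vdash\Gamma,A$ and $\vdash\Gamma,B$ respectively.
   Context: Named formulas and sequents. Fix a countably infinite set $\mathcal N$ of names and a set $\mathcal A$ of atoms with a fixpoint-free involution $\alpha\mapsto\bar\alpha$. Named formulas: $A,B::=\alpha^x\mid A\lor B\mid A\land B$ ($\alpha\in\mathcal A$, $x\in\mathcal N$). $\mathrm{names}(A)$ is the set of names in $A$, $\mathrm{names}(\Gamma)=\bigcup_{A\in\Gamma}\mathrm{names}(A)$. A formula is sharing-free if each name occurs in it at most once; a set is sharing-free if its members are sharing-free with pairwise disjoint name sets. A sequent $\vdash\Gamma$ is a finite sharing-free set $\Gamma$; $\Gamma,A=\Gamma\cup\{A\}$. For sharing-free $\Gamma$ and $x\in\mathrm{names}(\Gamma)$, $\Gamma[x]$ is the unique atom $\alpha$ with $\alpha^x$ a subformula of a member of $\Gamma$. Branches. $\mathrm{Br}(\alpha^x)=\{\{x\}\}$, $\mathrm{Br}(B\lor C)=\{X\cup Y\mid X\in\mathrm{Br}(B),Y\in\mathrm{Br}(C)\}$, $\mathrm{Br}(B\land C)=\mathrm{Br}(B)\cup\mathrm{Br}(C)$;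 for sharing-free $\Gamma$, $\mathrm{Br}(\Gamma)=\{X\subseteq\mathrm{names}(\Gamma)\mid\forall A\in\Gamma,\ X\cap\mathrm{names}(A)\in\mathrm{Br}(A)\}$. Branch-labeled graphs. A bl-graph is $G=\langle V_G,\triangleleft_G\rangle$ with $V_G\subseteq\mathcal N$ and $\triangleleft_G$ a relation between 2-element subsets $e$ of $V_G$ and subsets $X\subseteq V_G$ such that $e\triangleleft_G X$ implies $e\subseteq X$; edges $E_G=\{e\mid\exists X.\,e\triangleleft_G X\}$, branches $\mathrm{Br}(G)=\{X\mid\exists e.\,e\triangleleft_G X\}$. Union $\sqcup$ is componentwise union of vertex sets and relations. Restriction: $G{\upharpoonright}_X=\langle V_G\cap X,\{(e,Y)\in\triangleleft_G\mid Y\subseteq X\}\rangle$. Totality. A bl-graph $G$ is total w.r.t. a sharing-free sequent $\vdash\Gamma$ iff (i) $V_G=\mathrm{names}(\Gamma)$; (ii) $\mathrm{Br}(G)=\mathrm{Br}(\Gamma)$; (iii) for all $xy\in E_G$, $\Gamma[x]=\overline{\Gamma[y]}$. -}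

module Defs where

open import Level using (0ℓ)
import Level
open import Data.Nat using (ℕ)
open import Data.Product using (Σ; ∃; ∃-syntax; _×_; _,_; proj₁; proj₂)
open import Data.Sum using (_⊎_; inj₁; inj₂)
open import Data.List using (List; _∷_)
open import Data.List.Relation.Unary.All using (All)
open import Data.List.Relation.Unary.Any using (Any)
open import Data.List.Relation.Unary.AllPairs using (AllPairs)
open import Relation.Binary.PropositionalEquality using (_≡_; _≢_)
open import Relation.Unary using (Pred; _⊆_; _≐_; _∪_; _∩_; ｛_｝; Empty)

Name : Set
Name = ℕ

-- Sets of names are represented as predicates; set equality is _≐_
-- (mutual inclusion).
NSet : Set₁
NSet = Pred Name 0ℓ

-- Atoms: an arbitrary type (the involution is a hypothesis of the theorem).
data Formula (Atom : Set) : Set where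
  atom : Atom → Name → Formula Atom
  _∨f_ : Formula Atom → Formula Atom → Formula Atom
  _∧f_ : Formula Atom → Formula Atom → Formula Atom

module _ {Atom : Set} where

  namesF : Formula Atom → NSet
  namesF (atom α x) = ｛ x ｝
  namesF (A ∨f B)   = namesF A ∪ namesF B
  namesF (A ∧f B)   = namesF A ∪ namesF B

  names : List (Formula Atom) → NSet
  names Γ y = Any (λ A → namesF A y) Γ

  Disjoint : NSet → NSet → Set
  Disjoint X Y = Empty (X ∩ Y)

  SharingFreeF : Formula Atom → Set
  SharingFreeF (atom α x) = Data.Unit.⊤
    where import Data.Unit
  SharingFreeF (A ∨f B) = SharingFreeF A × SharingFreeF B × Disjoint (namesF A) (namesF B)
  SharingFreeF (A ∧f B) = SharingFreeF A × SharingFreeF B × Disjoint (namesF A) (namesF B)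

  -- sharing-free finite set (list; pairwise distinct members have disjoint names,
  -- which in particular forbids duplicates)
  SharingFree : List (Formula Atom) → Set
  SharingFree Γ = All SharingFreeF Γ × AllPairs (λ A B → Disjoint (namesF A) (namesF B)) Γ

  LabF : Formula Atom → Name → Atom → Set
  LabF (atom α x) y β = x ≡ y × α ≡ β
  LabF (A ∨f B) y β = LabF A y β ⊎ LabF B y β
  LabF (A ∧f B) y β = LabF A y β ⊎ LabF B y β

  Lab : List (Formula Atom) → Name → Atom → Set
  Lab Γ x α = Any (λ A → LabF A x α) Γ

  BrF : Formula Atom → Pred NSet (Level.suc 0ℓ)
  BrF (atom α x) X = Level.Lift (Level.suc 0ℓ) (X ≐ ｛ x ｝)
  BrF (A ∨f B) X = ∃[ Y ] ∃[ Z ] (BrF A Y × BrF B Z × Level.Lift (Level.suc 0ℓ) (X ≐ (Y ∪ Z)))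
  BrF (A ∧f B) X = BrF A X ⊎ BrF B X

  Br : List (Formula Atom) → Pred NSet (Level.suc 0ℓ)
  Br Γ X = Level.Lift (Level.suc 0ℓ) (X ⊆ names Γ) × All (λ A → BrF A (X ∩ namesF A)) Γ

TwoElem : NSet → Set
TwoElem e = ∃[ x ] ∃[ y ] (x ≢ y × e ≐ (｛ x ｝ ∪ ｛ y ｝))

record BLGraph : Set₁ where
  field
    V   : NSet
    _◁_ : NSet → NSet → Set
    ◁-two  : ∀ {e X} → e ◁ X → TwoElem e
    ◁-⊆    : ∀ {e X} → e ◁ X → e ⊆ X
    ◁-V    : ∀ {e X} → e ◁ X → X ⊆ V

  Edge : NSet → Set₁
  Edge e = ∃[ X ] (e ◁ X)

  BrG : NSet → Set₁
  BrG X = ∃[ e ] (e ◁ X)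

open BLGraph

_⊔_ : BLGraph → BLGraph → BLGraph
G ⊔ H = record
  { V = V G ∪ V H
  ; _◁_ = λ e X → _◁_ G e X ⊎ _◁_ H e X
  ; ◁-two = λ { (inj₁ p) → ◁-two G p ; (inj₂ p) → ◁-two H p }
  ; ◁-⊆ = λ { (inj₁ p) → ◁-⊆ G p ; (inj₂ p) → ◁-⊆ H p }
  ; ◁-V = λ { (inj₁ p) q → inj₁ (◁-V G p q) ; (inj₂ p) q → inj₂ (◁-V H p q) }
  }

_↾_ : BLGraph → NSet → BLGraph
G ↾ X = record
  { V = V G ∩ X
  ; _◁_ = λ e Y → _◁_ G e Y × Y ⊆ X
  ; ◁-two = λ p → ◁-two G (proj₁ p)
  ; ◁-⊆ = λ p → ◁-⊆ G (proj₁ p)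
  ; ◁-V = λ p q → ◁-V G (proj₁ p) q , proj₂ p q
  }

_≅_ : BLGraph → BLGraph → Set₁
G ≅ H = (V G ≐ V H) × (∀ e X → (_◁_ G e X → _◁_ H e X) × (_◁_ H e X → _◁_ G e X))

record Total {Atom : Set} (bar : Atom → Atom) (Γ : List (Formula Atom)) (G : BLGraph) : Set₁ where
  field
    total-V  : V G ≐ names Γ
    total-Br : ∀ X → (BrG G X → Br Γ X) × (Br Γ X → BrG G X)
    total-E  : ∀ e x y α β → Edge G e → e ≐ (｛ x ｝ ∪ ｛ y ｝) → x ≢ y →
               Lab Γ x α → Lab Γ y β → α ≡ bar β

module Submission where

open import Defs
open import Data.List using (List; _∷_)
open import Data.List.Relation.Unary.All using (All; _∷_)
open import Data.List.Relation.Unary.AllPairs using (_∷_)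
open import Data.List.Relation.Unary.Any using (here; there)
open import Data.Product using (_×_; _,_; proj₁; proj₂; map₂)
open import Data.Sum using (_⊎_; inj₁; inj₂; swap)
open import Data.Empty using (⊥-elim)
open import Function using (_∘_)
open import Level using (lift)
open import Relation.Binary.PropositionalEquality using (_≡_; _≢_; refl)
open import Relation.Unary using (_≐_; _∪_; _∩_; _⊆_; Satisfiable)

open BLGraph
open Total

-- A branch of the additive head A ∧ B of ⊢ Γ, A ∧ B lives entirely on the side of
-- A or of B; sharing-freeness then makes the branches of ⊢ Γ, A ∧ B lying inside
-- names(Γ, A) exactly the branches of ⊢ Γ, A. Restricting a total graph to
-- names(Γ, A) therefore keeps precisely the branches of ⊢ Γ, A, together with
-- their edges, whose labels are unchanged; the case of B follows by commuting ∧.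

↾-⊔-cover : ∀ G {X Y : NSet} → V G ⊆ X ∪ Y →
            (∀ {e Z} → _◁_ G e Z → Z ⊆ X ⊎ Z ⊆ Y) →
            G ≅ ((G ↾ X) ⊔ (G ↾ Y))
↾-⊔-cover G {X} {Y} V⊆X∪Y split = (cover , restricted) , λ e Z → cover◁ e Z , restricted◁ e Z
  where
  cover : V G ⊆ (V G ∩ X) ∪ (V G ∩ Y)
  cover v with V⊆X∪Y v
  ... | inj₁ x = inj₁ (v , x)
  ... | inj₂ y = inj₂ (v , y)
  restricted : (V G ∩ X) ∪ (V G ∩ Y) ⊆ V G
  restricted (inj₁ (v , _)) = v
  restricted (inj₂ (v , _)) = v
  cover◁ : ∀ e Z → _◁_ G e Z → _◁_ ((G ↾ X) ⊔ (G ↾ Y)) e Z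
  cover◁ e Z p with split p
  ... | inj₁ Z⊆X = inj₁ (p , Z⊆X)
  ... | inj₂ Z⊆Y = inj₂ (p , Z⊆Y)
  restricted◁ : ∀ e Z → _◁_ ((G ↾ X) ⊔ (G ↾ Y)) e Z → _◁_ G e Z
  restricted◁ e Z (inj₁ (p , _)) = p
  restricted◁ e Z (inj₂ (p , _)) = p

module _ {Atom : Set} where

  BrF-resp-≐ : ∀ (C : Formula Atom) {X Y} → X ≐ Y → BrF C X → BrF C Y
  BrF-resp-≐ (atom α x) (X⊆Y , Y⊆X) (lift (X⊆x , x⊆X)) = lift (X⊆x ∘ Y⊆X , X⊆Y ∘ x⊆X)
  BrF-resp-≐ (C ∨f D) (X⊆Y , Y⊆X) (U , W , bC , bD , lift (X⊆U∪W , U∪W⊆X)) =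
    U , W , bC , bD , lift (X⊆U∪W ∘ Y⊆X , X⊆Y ∘ U∪W⊆X)
  BrF-resp-≐ (C ∧f D) X≐Y (inj₁ bC) = inj₁ (BrF-resp-≐ C X≐Y bC)
  BrF-resp-≐ (C ∧f D) X≐Y (inj₂ bD) = inj₂ (BrF-resp-≐ D X≐Y bD)

  BrF⇒⊆namesF : ∀ (C : Formula Atom) {X} → BrF C X → X ⊆ namesF C
  BrF⇒⊆namesF (atom α x) (lift (X⊆x , _)) = X⊆x
  BrF⇒⊆namesF (C ∨f D) (U , W , bC , bD , lift (X⊆U∪W , _)) y∈X with X⊆U∪W y∈X
  ... | inj₁ y∈U = inj₁ (BrF⇒⊆namesF C bC y∈U)
  ... | inj₂ y∈W = inj₂ (BrF⇒⊆namesF D bD y∈W)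
  BrF⇒⊆namesF (C ∧f D) (inj₁ bC) = inj₁ ∘ BrF⇒⊆namesF C bC
  BrF⇒⊆namesF (C ∧f D) (inj₂ bD) = inj₂ ∘ BrF⇒⊆namesF D bD

  BrF⇒Satisfiable : ∀ (C : Formula Atom) {X} → BrF C X → Satisfiable X
  BrF⇒Satisfiable (atom α x) (lift (_ , x⊆X)) = x , x⊆X refl
  BrF⇒Satisfiable (C ∨f D) (U , W , bC , _ , lift (_ , U∪W⊆X)) =
    map₂ (U∪W⊆X ∘ inj₁) (BrF⇒Satisfiable C bC)
  BrF⇒Satisfiable (C ∧f D) (inj₁ bC) = BrF⇒Satisfiable C bC
  BrF⇒Satisfiable (C ∧f D) (inj₂ bD) = BrF⇒Satisfiable D bD

  names-∷⁺ : ∀ {C D : Formula Atom} {Γ} → namesF C ⊆ namesF D → names (C ∷ Γ) ⊆ names (D ∷ Γ)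
  names-∷⁺ C⊆D (here y∈C) = here (C⊆D y∈C)
  names-∷⁺ C⊆D (there y∈Γ) = there y∈Γ

  Lab-∷⁺ : ∀ {C D : Formula Atom} {Γ} → (∀ {x α} → LabF C x α → LabF D x α) →
           ∀ {x α} → Lab (C ∷ Γ) x α → Lab (D ∷ Γ) x α
  Lab-∷⁺ C⊆D (here l) = here (C⊆D l)
  Lab-∷⁺ C⊆D (there l) = there l

  Disjoint-names : ∀ {U : NSet} (Γ : List (Formula Atom)) →
                   All (Disjoint {Atom} U ∘ namesF) Γ → Disjoint {Atom} U (names Γ)
  Disjoint-names (C ∷ Γ) (U#C ∷ _) y (u , here y∈C) = U#C y (u , y∈C)
  Disjoint-names (C ∷ Γ) (_ ∷ U#Γ) y (u , there y∈Γ) = Disjoint-names Γ U#Γ y (u , y∈Γ)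

  names-∧-split : ∀ (A B : Formula Atom) Γ → names ((A ∧f B) ∷ Γ) ⊆ names (A ∷ Γ) ∪ names (B ∷ Γ)
  names-∧-split A B Γ (here (inj₁ y∈A)) = inj₁ (here y∈A)
  names-∧-split A B Γ (here (inj₂ y∈B)) = inj₂ (here y∈B)
  names-∧-split A B Γ (there y∈Γ) = inj₁ (there y∈Γ)

  Br-∧⇒⊆ : ∀ (A B : Formula Atom) Γ {X} → Br ((A ∧f B) ∷ Γ) X →
           X ⊆ names (A ∷ Γ) ⊎ X ⊆ names (B ∷ Γ)
  Br-∧⇒⊆ A B Γ {X} (lift X⊆ , inj₁ bA ∷ _) = inj₁ onA
    where
    onA : X ⊆ names (A ∷ Γ)
    onA y∈X with X⊆ y∈X
    ... | here y∈A∧B = here (BrF⇒⊆namesF A bA (y∈X , y∈A∧B))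
    ... | there y∈Γ = there y∈Γ
  Br-∧⇒⊆ A B Γ {X} (lift X⊆ , inj₂ bB ∷ _) = inj₂ onB
    where
    onB : X ⊆ names (B ∷ Γ)
    onB y∈X with X⊆ y∈X
    ... | here y∈A∧B = here (BrF⇒⊆namesF B bB (y∈X , y∈A∧B))
    ... | there y∈Γ = there y∈Γ

  module _ (A B : Formula Atom) (Γ : List (Formula Atom))
           (B#AΓ : Disjoint {Atom} (namesF B) (names (A ∷ Γ))) where

    ∩-∧-dropʳ : ∀ {X : NSet} → X ⊆ names (A ∷ Γ) → X ∩ namesF (A ∧f B) ≐ X ∩ namesF A
    ∩-∧-dropʳ {X} X⊆AΓ = dropB , map₂ inj₁
      where
      dropB : X ∩ namesF (A ∧f B) ⊆ X ∩ namesF A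
      dropB (y∈X , inj₁ y∈A) = y∈X , y∈A
      dropB (y∈X , inj₂ y∈B) = ⊥-elim (B#AΓ _ (y∈B , X⊆AΓ y∈X))

    Br-∧ˡ⁺ : ∀ {X : NSet} → Br (A ∷ Γ) X → Br ((A ∧f B) ∷ Γ) X
    Br-∧ˡ⁺ (lift X⊆AΓ , bA ∷ bΓ) =
      lift (names-∷⁺ inj₁ ∘ X⊆AΓ) ,
      inj₁ (BrF-resp-≐ A (proj₂ (∩-∧-dropʳ X⊆AΓ) , proj₁ (∩-∧-dropʳ X⊆AΓ)) bA) ∷ bΓ

    -- A branch through B would contain a name of B, which X ⊆ names(Γ, A) excludes.
    Br-∧ˡ⁻ : ∀ {X : NSet} → X ⊆ names (A ∷ Γ) → Br ((A ∧f B) ∷ Γ) X → Br (A ∷ Γ) X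
    Br-∧ˡ⁻ X⊆AΓ (_ , inj₁ bA ∷ bΓ) = lift X⊆AΓ , BrF-resp-≐ A (∩-∧-dropʳ X⊆AΓ) bA ∷ bΓ
    Br-∧ˡ⁻ X⊆AΓ (_ , inj₂ bB ∷ _) with BrF⇒Satisfiable B bB
    ... | y , y∈X∩A∧B = ⊥-elim (B#AΓ y (BrF⇒⊆namesF B bB y∈X∩A∧B , X⊆AΓ (proj₁ y∈X∩A∧B)))

    Total-∧ˡ : ∀ {bar G} → Total bar ((A ∧f B) ∷ Γ) G → Total bar (A ∷ Γ) (G ↾ names (A ∷ Γ))
    total-V (Total-∧ˡ T) = proj₂ , λ y∈AΓ → proj₂ (total-V T) (names-∷⁺ inj₁ y∈AΓ) , y∈AΓ
    total-Br (Total-∧ˡ {G = G} T) X = restrictedBranch , branchOfA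
      where
      restrictedBranch : BrG (G ↾ names (A ∷ Γ)) X → Br (A ∷ Γ) X
      restrictedBranch (e , e◁X , X⊆AΓ) = Br-∧ˡ⁻ X⊆AΓ (proj₁ (total-Br T X) (e , e◁X))
      branchOfA : Br (A ∷ Γ) X → BrG (G ↾ names (A ∷ Γ)) X
      branchOfA bA@(lift X⊆AΓ , _) with proj₂ (total-Br T X) (Br-∧ˡ⁺ bA)
      ... | e , e◁X = e , e◁X , X⊆AΓ
    total-E (Total-∧ˡ T) e x y α β (Z , e◁Z , _) e≐xy x≢y x:α y:β =
      total-E T e x y α β (Z , e◁Z) e≐xy x≢y (Lab-∷⁺ inj₁ x:α) (Lab-∷⁺ inj₁ y:β)

  Br-∧-comm : ∀ (A B : Formula Atom) Γ {X : NSet} → Br ((A ∧f B) ∷ Γ) X → Br ((B ∧f A) ∷ Γ) X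
  Br-∧-comm A B Γ (lift X⊆ , b ∷ bΓ) =
    lift (names-∷⁺ swap ∘ X⊆) , BrF-resp-≐ (B ∧f A) (map₂ swap , map₂ swap) (swap b) ∷ bΓ

  Total-∧-comm : ∀ {bar} (A B : Formula Atom) Γ {G} →
                 Total bar ((A ∧f B) ∷ Γ) G → Total bar ((B ∧f A) ∷ Γ) G
  total-V (Total-∧-comm A B Γ T) =
    names-∷⁺ swap ∘ proj₁ (total-V T) , proj₂ (total-V T) ∘ names-∷⁺ swap
  total-Br (Total-∧-comm A B Γ T) X =
    Br-∧-comm A B Γ ∘ proj₁ (total-Br T X) , proj₂ (total-Br T X) ∘ Br-∧-comm B A Γ
  total-E (Total-∧-comm A B Γ T) e x y α β edge e≐xy x≢y x:α y:β =
    total-E T e x y α β edge e≐xy x≢y (Lab-∷⁺ swap x:α) (Lab-∷⁺ swap y:β)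

lemma19 : (Atom : Set) (bar : Atom → Atom) →
          (∀ a → bar (bar a) ≡ a) → (∀ a → bar a ≢ a) →
          (Γ : List (Formula Atom)) (A B : Formula Atom) (G : BLGraph) →
          SharingFree ((A ∧f B) ∷ Γ) →
          Total bar ((A ∧f B) ∷ Γ) G →
          (G ≅ ((G ↾ names (A ∷ Γ)) ⊔ (G ↾ names (B ∷ Γ))))
          × Total bar (A ∷ Γ) (G ↾ names (A ∷ Γ))
          × Total bar (B ∷ Γ) (G ↾ names (B ∷ Γ))
lemma19 Atom bar _ _ Γ A B G ((_ , _ , A#B) ∷ _ , A∧B#Γ ∷ _) T =
  ↾-⊔-cover G (names-∧-split A B Γ ∘ proj₁ (total-V T))
              (λ e◁Z → Br-∧⇒⊆ A B Γ (proj₁ (total-Br T _) (_ , e◁Z))) ,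
  Total-∧ˡ A B Γ B#AΓ T ,
  Total-∧ˡ B A Γ A#BΓ (Total-∧-comm A B Γ T)
  where
  A∧B#names-Γ : Disjoint {Atom} (namesF (A ∧f B)) (names Γ)
  A∧B#names-Γ = Disjoint-names Γ A∧B#Γ
  B#AΓ : Disjoint {Atom} (namesF B) (names (A ∷ Γ))
  B#AΓ y (y∈B , here y∈A) = A#B y (y∈A , y∈B)
  B#AΓ y (y∈B , there y∈Γ) = A∧B#names-Γ y (inj₂ y∈B , y∈Γ)
  A#BΓ : Disjoint {Atom} (namesF A) (names (B ∷ Γ))
  A#BΓ y (y∈A , here y∈B) = A#B y (y∈A , y∈B)
  A#BΓ y (y∈A , there y∈Γ) = A∧B#names-Γ y (inj₁ y∈A , y∈Γ)
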